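{- Let $H$ be a retract of a graph $G$, and let $m,r,s$ be positive integers. If the revolutionaries win $\mathrm{RS}(H,m,r,s)$, then the revolutionaries win $\mathrm{RS}(G,m,r,s)$. Equivalently, $\sigma(G,m,r)\ge\sigma(H,m,r)$.
   Context: An induced subgraph $H$ of $G$ is a retract of $G$ if there is a map $f:V(G)\to V(H)$ with $f(v)=v$ for all $v\in V(H)$ and such that $uv\in E(G)$ implies $f(u)$ and $f(v)$ are equal or adjacent. The game $\mathrm{RS}(G,m,r,s)$ is played on a finite graph $G$ by $r$ revolutionaries and $s$ spies. First each revolutionary occupies a vertex, then each spy occupies a vertex (several players may share a vertex). In each subsequent round, each revolutionary may move to an adjacent vertex or stay put, and then each spy may move to an adjacent vertex or stay put; all positions are known to all players. The revolutionaries win if at the end of some round (the initial placement counts as a round) some vertex holds at least $m$ revolutionaries and no spy; the spies win if this never happens. $\sigma(G,m,r)$ denotes the minimum $s$ such that the spies have a winning strategy in $\mathrm{RS}(G,m,r,s)$. -}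

module Defs where

open import Data.Nat using (ℕ; zero; suc; _≤_)
open import Data.Fin using (Fin; _≟_)
open import Data.List using (List; []; _∷_; length; filter; allFin)
open import Data.Product using (Σ; _×_; _,_; proj₁; proj₂)
open import Data.Sum using (_⊎_)
open import Relation.Binary.PropositionalEquality using (_≡_; _≢_)
open import Relation.Nullary using (¬_)
open import Function using (_∘_)
open import Function.Definitions using (Injective)

record Graph : Set₁ where
  field
    n     : ℕ
    Adj   : Fin n → Fin n → Set
    sym   : ∀ {u v} → Adj u v → Adj v u
    irrefl : ∀ {v} → ¬ Adj v v

open Graph public

Vtx : Graph → Set
Vtx G = Fin (n G)

-- H is an induced subgraph of G, witnessed by an injective vertex map ι
-- (identifying V(H) with a subset of V(G)) such that the edges of H are
-- exactly the edges of G between vertices of (the image of) H.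
record InducedSubgraph (H G : Graph) : Set where
  field
    ι      : Vtx H → Vtx G
    ι-inj  : Injective _≡_ _≡_ ι
    induced-to   : ∀ {a b} → Adj H a b → Adj G (ι a) (ι b)
    induced-from : ∀ {a b} → Adj G (ι a) (ι b) → Adj H a b

record Retract (H G : Graph) : Set where
  field
    sub : InducedSubgraph H G
    f   : Vtx G → Vtx H
    f-fix  : ∀ a → f (InducedSubgraph.ι sub a) ≡ a
    f-edge : ∀ {u v} → Adj G u v → f u ≡ f v ⊎ Adj H (f u) (f v)

Config : Graph → ℕ → Set
Config G k = Fin k → Vtx G

Step : (G : Graph) {k : ℕ} → Config G k → Config G k → Set
Step G P Q = ∀ i → P i ≡ Q i ⊎ Adj G (P i) (Q i)

count : (G : Graph) {r : ℕ} → Config G r → Vtx G → ℕ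
count G {r} R v = length (filter (λ i → R i ≟ v) (allFin r))

-- past configurations (end-of-round positions), most recent first
History : Graph → ℕ → ℕ → Set
History G r s = List (Config G r × Config G s)

record RevStrategy (G : Graph) (r s : ℕ) : Set where
  field
    start : Config G r
    move  : (R : Config G r) (S : Config G s) → History G r s →
            Σ (Config G r) (Step G R)

record SpyStrategy (G : Graph) (r s : ℕ) : Set where
  field
    start : Config G r → Config G s
    move  : (R : Config G r) (S : Config G s) → History G r s →
            (R' : Config G r) → Σ (Config G s) (Step G S)

record State (G : Graph) (r s : ℕ) : Set where
  constructor state
  field
    revs  : Config G r
    spies : Config G s
    past  : History G r s

-- positions at the end of round t (round 0 = initial placement)
play : {G : Graph} {r s : ℕ} → RevStrategy G r s → SpyStrategy G r s →
       ℕ → State G r s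
play ρ σ zero =
  state (RevStrategy.start ρ) (SpyStrategy.start σ (RevStrategy.start ρ)) []
play ρ σ (suc t) with play ρ σ t
... | state R S h =
  let R' = proj₁ (RevStrategy.move ρ R S h)
      S' = proj₁ (SpyStrategy.move σ R S h R')
  in state R' S' ((R , S) ∷ h)

RevsWinAt : (G : Graph) (m : ℕ) {r s : ℕ} → Config G r → Config G s → Set
RevsWinAt G m R S = Σ (Vtx G) λ v → (m ≤ count G R v) × (∀ j → S j ≢ v)

RevolutionariesWin : (G : Graph) (m r s : ℕ) → Set
RevolutionariesWin G m r s =
  Σ (RevStrategy G r s) λ ρ → (σ : SpyStrategy G r s) →
    Σ ℕ λ t → RevsWinAt G m (State.revs (play ρ σ t)) (State.spies (play ρ σ t))

module Submission where

-- A retract H of G lets the revolutionaries of G play a winning strategy ρH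
-- of H "in the image" ι(H) ⊆ G.  The retraction f projects every spy move in
-- G to a legal spy move in H (f sends edges to edges or single vertices), so
-- any spy strategy σ on G induces a spy strategy σH on H, and the
-- revolutionaries on G keep their positions equal to ι applied to the
-- shadow positions that ρH produces against the projected spies.  When ρH
-- wins against σH at round t at a vertex v, the vertex ι v carries the same
-- number of revolutionaries (ι is injective) and no spy (a spy on ι v would
-- project to f (ι v) = v).

open import Defs hiding (sym)
open import Data.Nat using (ℕ; _≤_; zero; suc)
open import Data.Fin using (_≟_)
open import Data.Fin.Properties using (all?)
open import Data.List using ([]; _∷_; length; allFin)
open import Data.List.Properties using (filter-≐)
open import Data.Product using (Σ; _×_; _,_; proj₁; proj₂)
open import Data.Sum using (_⊎_; inj₁; inj₂)
open import Data.Empty using (⊥-elim)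
open import Function using (_∘_)
open import Function.Definitions using (Injective)
open import Relation.Binary.PropositionalEquality
  using (_≡_; refl; sym; trans; cong; cong-app; subst; module ≡-Reasoning)
open import Relation.Nullary using (yes; no)

stay : (G : Graph) {k : ℕ} (P : Config G k) → Step G P P
stay G P i = inj₁ refl

step-cong : (G : Graph) {k : ℕ} {P P′ Q : Config G k} →
            (∀ i → P i ≡ P′ i) → Step G P′ Q → Step G P Q
step-cong G eq st i with st i
... | inj₁ e = inj₁ (trans (eq i) e)
... | inj₂ a = inj₂ (subst (λ x → Adj G x _) (sym (eq i)) a)

WeakHom : (A B : Graph) → (Vtx A → Vtx B) → Set
WeakHom A B g = ∀ {u v} → Adj A u v → g u ≡ g v ⊎ Adj B (g u) (g v)

step-map : (A B : Graph) (g : Vtx A → Vtx B) → WeakHom A B g →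
           {k : ℕ} {P Q : Config A k} → Step A P Q → Step B (g ∘ P) (g ∘ Q)
step-map A B g hom st i with st i
... | inj₁ e = inj₁ (cong g e)
... | inj₂ a = hom a

count-inj : (A B : Graph) (g : Vtx A → Vtx B) → Injective _≡_ _≡_ g →
            {r : ℕ} (R : Config A r) (v : Vtx A) →
            count A R v ≡ count B (g ∘ R) (g v)
count-inj A B g g-inj {r} R v =
  cong length (filter-≐ (λ i → R i ≟ v) (λ i → g (R i) ≟ g v)
                        (cong g , g-inj) (allFin r))

-- A move prepared for the expected positions P₀, made legal from the actual
-- positions P by checking P = P₀ and staying put otherwise.
guarded : (G : Graph) {k : ℕ} (P P₀ : Config G k) →
          Σ (Config G k) (Step G P₀) → Σ (Config G k) (Step G P)
guarded G P P₀ mv with all? (λ i → P i ≟ P₀ i)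
... | yes eq = proj₁ mv , step-cong G eq (proj₂ mv)
... | no _   = P , stay G P

guarded-on-track : (G : Graph) {k : ℕ} (P P₀ : Config G k)
                   (mv : Σ (Config G k) (Step G P₀)) →
                   P ≡ P₀ → proj₁ (guarded G P P₀ mv) ≡ proj₁ mv
guarded-on-track G P P₀ mv eq with all? (λ i → P i ≟ P₀ i)
... | yes _  = refl
... | no neq = ⊥-elim (neq (cong-app eq))

round : {G : Graph} {r s : ℕ} → RevStrategy G r s → SpyStrategy G r s →
        State G r s → State G r s
round ρ σ (state R S h) =
  let R′ = proj₁ (RevStrategy.move ρ R S h)
  in state R′ (proj₁ (SpyStrategy.move σ R S h R′)) ((R , S) ∷ h)

-- After t rounds the history records exactly t earlier positions; this lets
-- a strategy read off the current round from the history.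
play-length : {G : Graph} {r s : ℕ} (ρ : RevStrategy G r s)
              (σ : SpyStrategy G r s) (t : ℕ) →
              length (State.past (play ρ σ t)) ≡ t
play-length ρ σ zero    = refl
play-length ρ σ (suc t) = cong suc (play-length ρ σ t)

module OnRetract {G H : Graph} (ret : Retract H G) where
  open Retract ret
  open InducedSubgraph sub

  ι-weakHom : WeakHom H G ι
  ι-weakHom a = inj₂ (induced-to a)

  -- A winning position of H against the projected spies lifts to a winning
  -- position of G: the vertex ι v has as many revolutionaries as v, and a
  -- spy on ι v would project onto f (ι v) = v.
  retract-win : {m r s : ℕ} (R : Config H r) (S : Config G s) →
                RevsWinAt H m R (f ∘ S) → RevsWinAt G m (ι ∘ R) S
  retract-win {m} R S (v , crowded , spy-free) =
    ι v , subst (m ≤_) (count-inj H G ι ι-inj R v) crowded ,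
    λ j onιv → spy-free j (trans (cong f onιv) (f-fix v))

  module Simulation {r s : ℕ} (ρH : RevStrategy H r s) where

    -- The shadow play in H replayed from a history of G: the positions
    -- ρH reaches, and the H-history, against the projected spies.
    replay : History G r s → Config H r × History H r s
    replay [] = RevStrategy.start ρH , []
    replay ((R , S) ∷ h) with replay h
    ... | (RH , hH) =
      proj₁ (RevStrategy.move ρH RH (f ∘ S) hH) , ((RH , f ∘ S) ∷ hH)

    replay-length : (h : History G r s) → length (proj₂ (replay h)) ≡ length h
    replay-length []      = refl
    replay-length (_ ∷ h) = cong suc (replay-length h)

    moveG : (R : Config G r) (S : Config G s) → History G r s →
            Σ (Config G r) (Step G R)
    moveG R S h =
      guarded G R (ι ∘ RH) (ι ∘ proj₁ mv , step-map H G ι ι-weakHom (proj₂ mv))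
      where
        RH = proj₁ (replay h)
        mv = RevStrategy.move ρH RH (f ∘ S) (proj₂ (replay h))

    ρG : RevStrategy G r s
    ρG = record { start = ι ∘ RevStrategy.start ρH ; move = moveG }

    module Against (σ : SpyStrategy G r s) where
      PG : ℕ → State G r s
      PG = play ρG σ

      SG : ℕ → Config G s
      SG t = State.spies (PG t)

      spy-step : ∀ t → Step G (SG t) (SG (suc t))
      spy-step t = proj₂ (SpyStrategy.move σ (State.revs (PG t)) (SG t)
                            (State.past (PG t)) (State.revs (PG (suc t))))

      -- In round t (read off from the history) the H-spies move to the
      -- projection of the G-spies' positions in round t + 1.
      moveH : (R : Config H r) (S : Config H s) → History H r s →
              (R′ : Config H r) → Σ (Config H s) (Step H S)
      moveH R S h R′ =
        guarded H S (f ∘ SG t) (f ∘ SG (suc t) , step-map G H f f-edge (spy-step t))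
        where t = length h

      σH : SpyStrategy H r s
      σH = record { start = λ _ → f ∘ SG zero ; move = moveH }

      PH : ℕ → State H r s
      PH = play ρH σH

      moveH-on-track : (R : Config H r) (S : Config H s) (h : History H r s)
                       (R′ : Config H r) (t : ℕ) → length h ≡ t →
                       S ≡ f ∘ SG t → proj₁ (moveH R S h R′) ≡ f ∘ SG (suc t)
      moveH-on-track R S h R′ t refl onTrack = guarded-on-track H S _ _ onTrack

      shadow : State G r s → State H r s
      shadow (state R S h) = state (proj₁ (replay h)) (f ∘ S) (proj₂ (replay h))

      tracks : ∀ t → State.revs (PG t) ≡ ι ∘ State.revs (shadow (PG t))
      tracks zero    = refl
      tracks (suc t) = guarded-on-track G _ _ _ (tracks t)

      shadow-play : ∀ t → PH t ≡ shadow (PG t)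
      shadow-play zero    = refl
      shadow-play (suc t) = begin
          PH (suc t)
        ≡⟨ cong (round ρH σH) (shadow-play t) ⟩
          round ρH σH (shadow (PG t))
        ≡⟨ cong (λ S′ → state RH′ S′ ((RH , f ∘ SG t) ∷ hH))
                (moveH-on-track RH (f ∘ SG t) hH RH′ t hH-length refl) ⟩
          shadow (PG (suc t))
        ∎
        where
          open ≡-Reasoning
          RH  = State.revs (shadow (PG t))
          hH  = State.past (shadow (PG t))
          RH′ = proj₁ (RevStrategy.move ρH RH (f ∘ SG t) hH)
          hH-length : length hH ≡ t
          hH-length = trans (replay-length (State.past (PG t))) (play-length ρG σ t)

      transfer : ∀ {m} t → RevsWinAt H m (State.revs (PH t)) (State.spies (PH t)) →
                 RevsWinAt G m (State.revs (PG t)) (SG t)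
      transfer {m} t winH =
        subst (λ R → RevsWinAt G m R (SG t)) (sym (tracks t))
          (retract-win (State.revs (shadow (PG t))) (SG t)
            (subst (λ st → RevsWinAt H m (State.revs st) (State.spies st))
                   (shadow-play t) winH))

theorem4p6 : (G H : Graph) → Retract H G → (m r s : ℕ) →
    1 ≤ m → 1 ≤ r → 1 ≤ s →
    RevolutionariesWin H m r s → RevolutionariesWin G m r s
theorem4p6 G H ret m r s _ _ _ (ρH , ρH-wins) = ρG , λ σ →
  let open Against σ
      (t , winH) = ρH-wins σH
  in t , transfer t winH
  where open OnRetract ret
        open Simulation ρH
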